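{- Let $n>0$. There exist a structure $\mathfrak{S}$ over a reflexive, transitive frame and a world $w_0$ of $\mathfrak{S}$ such that $\mathfrak{S}\models_{w_0}\Gamma$, where $\Gamma=\Gamma_1\cup\Gamma_2\cup\Gamma_{3,h}\cup\Gamma_{3,v}$.
   Context: Graded modal formulas are built from proposition letters using Boolean connectives and $\Diamond_{\leq C},\Diamond_{\geq C}$. Satisfaction in a structure $(W,R,V)$: $\Diamond_{\geq C}\psi$ (resp. $\Diamond_{\le C}\psi$) holds at $w$ iff at least (resp. at most) $C$ worlds $v$ with $(w,v)\in R$ satisfy $\psi$. $\Box\psi$ abbreviates $\Diamond_{\le0}\neg\psi$, $\Diamond\psi$ abbreviates $\Diamond_{\ge1}\psi$, and $\boxdot\psi$ abbreviates $\psi\wedge\Box\psi$. The proposition letters used are $u_0,\dots,u_n,v_0,\dots,v_n,p_1,\dots,p_n,q_1,\dots,q_n,z,o_h,o_v$. $\Gamma_1$ is the set of the following formulas: (a) $u_0\wedge v_0\wedge z$; (b) $\boxdot(\neg(u_i\wedge u_j)\wedge\neg(v_i\wedge v_j))$ for $0\le i<j\le n$; (c) $\boxdot(u_i\wedge v_j\wedge z\to\Diamond(u_{i+1}\wedge v_j\wedge z\wedge\sigma))$ for $0\le i<n$, $0\le j\le n$, $\sigma\in\{p_{i+1},\neg p_{i+1}\}$; (d) $\boxdot(u_i\wedge v_j\wedge z\to\Diamond(u_i\wedge v_{j+1}\wedge z\wedge\sigma))$ for $0\le i\le n$, $0\le j<n$, $\sigma\in\{q_{j+1},\neg q_{j+1}\}$;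 (e) $\Box(u_i\wedge\sigma\to\Box(z\to\sigma))$ for $1\le k\le i\le n$, $\sigma\in\{p_k,\neg p_k\}$; (f) $\Box(v_j\wedge\sigma\to\Box(z\to\sigma))$ for $1\le k\le j\le n$, $\sigma\in\{q_k,\neg q_k\}$. $\Gamma_2$ is the set of the following formulas: (g) $\boxdot(u_i\wedge v_j\to\Diamond_{\le1}(u_{i+1}\wedge v_j\wedge\sigma))$ for $0\le i<n$, $0\le j\le n$, $\sigma\in\{p_{i+1},\neg p_{i+1}\}$; (h) $\boxdot(u_i\wedge v_j\to\Diamond_{\le1}(u_i\wedge v_{j+1}\wedge\sigma))$ for $0\le i\le n$, $0\le j<n$, $\sigma\in\{q_{j+1},\neg q_{j+1}\}$; (i) $\boxdot(u_i\wedge v_j\to\Diamond_{\le1}(u_{i+1}\wedge v_{j+1}\wedge\sigma\wedge\tau))$ for $0\le i<n$, $0\le j<n$, $\sigma\in\{p_{i+1},\neg p_{i+1}\}$, $\tau\in\{q_{j+1},\neg q_{j+1}\}$. For $1\le i\le n$, let $p_i^*=\neg p_i\wedge p_{i+1}\wedge\cdots\wedge p_n$, $p_i^+=p_i\wedge\neg p_{i+1}\wedge\cdots\wedge\neg p_n$, and similarly $q_i^*,q_i^+$ with $q$ in place of $p$. $\Gamma_{3,h}$ is the set of the following formulas, for $1\le i\le n$: $\Box(u_n\wedge v_n\wedge p_i^*\to\Diamond(o_h\wedge p_i^+))$; $\Box(u_n\wedge v_n\wedge p_i^+\to\Diamond(o_h\wedge p_i^+))$; $\Box(u_{i-1}\wedge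 v_n\to\Diamond_{\le1}(o_h\wedge p_i^+))$. $\Gamma_{3,v}$ is the set of the following formulas, for $1\le i\le n$: $\Box(u_n\wedge v_n\wedge q_i^*\to\Diamond(o_v\wedge q_i^+))$; $\Box(u_n\wedge v_n\wedge q_i^+\to\Diamond(o_v\wedge q_i^+))$; $\Box(u_n\wedge v_{i-1}\to\Diamond_{\le1}(o_v\wedge q_i^+))$. -}

module Defs where

open import Data.Nat using (ℕ; zero; suc; _<_; _≤_)
open import Data.Fin using (Fin; toℕ; inject₁; fromℕ) renaming (zero to fz; suc to fs)
open import Data.Bool using (Bool; T)
open import Data.List using (List; []; _∷_; filter; map)
open import Data.List using (allFin) public
open import Data.Product using (Σ; _×_; _,_)
open import Data.Sum using (_⊎_)
open import Data.Unit using (⊤)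
open import Relation.Nullary using (¬_)
open import Relation.Binary.PropositionalEquality using (_≡_)
open import Function.Definitions using (Injective)

-- Proposition letters for a fixed n:
--   u i  (i : Fin (suc n))  is  u_i,  0 ≤ i ≤ n
--   v j  (j : Fin (suc n))  is  v_j,  0 ≤ j ≤ n
--   p k  (k : Fin n)        is  p_{k+1},  so p_1 … p_n
--   q k  (k : Fin n)        is  q_{k+1},  so q_1 … q_n
--   z, oh (= o_h), ov (= o_v)

data Letter (n : ℕ) : Set where
  u v : Fin (suc n) → Letter n
  p q : Fin n → Letter n
  z oh ov : Letter n

infixr 4 _⇒_
infixr 5 _∨_
infixr 6 _∧_

data Form (n : ℕ) : Set where
  var   : Letter n → Form n
  ⊤f    : Form n
  ~_    : Form n → Form n
  _∧_   : Form n → Form n → Form n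
  _∨_   : Form n → Form n → Form n
  _⇒_   : Form n → Form n → Form n
  ◇≤    : ℕ → Form n → Form n
  ◇≥    : ℕ → Form n → Form n

module _ {n : ℕ} where
  □ : Form n → Form n
  □ ψ = ◇≤ 0 (~ ψ)

  ◇ : Form n → Form n
  ◇ ψ = ◇≥ 1 ψ

  ⊡ : Form n → Form n
  ⊡ ψ = ψ ∧ □ ψ

  ⋀ : List (Form n) → Form n
  ⋀ []       = ⊤f
  ⋀ (φ ∷ φs) = φ ∧ ⋀ φs

record Structure (n : ℕ) : Set₁ where
  field
    W : Set
    R : W → W → Set
    V : W → Letter n → Bool
open Structure public

AtLeast : {W : Set} (R : W → W → Set) → W → ℕ → (W → Set) → Set
AtLeast {W} R w C P =
  Σ (Fin C → W) λ f → Injective _≡_ _≡_ f × ((k : Fin C) → R w (f k) × P (f k))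

AtMost : {W : Set} (R : W → W → Set) → W → ℕ → (W → Set) → Set
AtMost R w C P = ¬ AtLeast R w (suc C) P

_,_⊨_ : {n : ℕ} (S : Structure n) → W S → Form n → Set
S , w ⊨ var a    = T (V S w a)
S , w ⊨ ⊤f       = ⊤
S , w ⊨ (~ φ)    = ¬ (S , w ⊨ φ)
S , w ⊨ (φ ∧ ψ)  = (S , w ⊨ φ) × (S , w ⊨ ψ)
S , w ⊨ (φ ∨ ψ)  = (S , w ⊨ φ) ⊎ (S , w ⊨ ψ)
S , w ⊨ (φ ⇒ ψ)  = (S , w ⊨ φ) → (S , w ⊨ ψ)
S , w ⊨ ◇≤ C φ   = AtMost  (R S) w C (λ x → S , x ⊨ φ)
S , w ⊨ ◇≥ C φ   = AtLeast (R S) w C (λ x → S , x ⊨ φ)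

module _ {n : ℕ} where
  U V' : Fin (suc n) → Form n
  U i = var (u i)
  V' j = var (v j)
  P Q : Fin n → Form n
  P k = var (p k)
  Q k = var (q k)
  Z Oh Ov : Form n
  Z = var z
  Oh = var oh
  Ov = var ov

  data Lit (φ : Form n) : Form n → Set where
    pos : Lit φ φ
    neg : Lit φ (~ φ)

  -- indices strictly above k (k, l : Fin n, meaning k+1, l+1)
  above : Fin n → List (Fin n)
  above k = filter (λ l → Data.Nat._<?_ (toℕ k) (toℕ l)) (allFin n)

  -- p_i^* = ¬p_i ∧ p_{i+1} ∧ … ∧ p_n   (i = k+1)
  -- p_i^+ = p_i ∧ ¬p_{i+1} ∧ … ∧ ¬p_n
  pStar pPlus qStar qPlus : Fin n → Form n
  pStar k = ~ P k ∧ ⋀ (map P (above k))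
  pPlus k = P k ∧ ⋀ (map (λ l → ~ P l) (above k))
  qStar k = ~ Q k ∧ ⋀ (map Q (above k))
  qPlus k = Q k ∧ ⋀ (map (λ l → ~ Q l) (above k))

  top : Fin (suc n)
  top = fromℕ n

  -- Γ = Γ₁ ∪ Γ₂ ∪ Γ₃,h ∪ Γ₃,v.  In the index conventions below,
  -- i : Fin n in (c),(g),(i) stands for 0 ≤ i < n with u_i = U (inject₁ i),
  -- u_{i+1} = U (fs i), p_{i+1} = P i; similarly for j.
  data Γ : Form n → Set where
    a : Γ (U fz ∧ V' fz ∧ Z)
    b : (i j : Fin (suc n)) → toℕ i < toℕ j →
        Γ (⊡ (~ (U i ∧ U j) ∧ ~ (V' i ∧ V' j)))
    c : (i : Fin n) (j : Fin (suc n)) (σ : Form n) → Lit (P i) σ →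
        Γ (⊡ (U (inject₁ i) ∧ V' j ∧ Z ⇒ ◇ (U (fs i) ∧ V' j ∧ Z ∧ σ)))
    d : (i : Fin (suc n)) (j : Fin n) (σ : Form n) → Lit (Q j) σ →
        Γ (⊡ (U i ∧ V' (inject₁ j) ∧ Z ⇒ ◇ (U i ∧ V' (fs j) ∧ Z ∧ σ)))
    -- (e): 1 ≤ k ≤ i ≤ n, with k = k' + 1, i.e. toℕ k' < toℕ i
    e : (k : Fin n) (i : Fin (suc n)) → toℕ k < toℕ i → (σ : Form n) → Lit (P k) σ →
        Γ (□ (U i ∧ σ ⇒ □ (Z ⇒ σ)))
    f : (k : Fin n) (j : Fin (suc n)) → toℕ k < toℕ j → (σ : Form n) → Lit (Q k) σ →
        Γ (□ (V' j ∧ σ ⇒ □ (Z ⇒ σ)))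
    g : (i : Fin n) (j : Fin (suc n)) (σ : Form n) → Lit (P i) σ →
        Γ (⊡ (U (inject₁ i) ∧ V' j ⇒ ◇≤ 1 (U (fs i) ∧ V' j ∧ σ)))
    h : (i : Fin (suc n)) (j : Fin n) (σ : Form n) → Lit (Q j) σ →
        Γ (⊡ (U i ∧ V' (inject₁ j) ⇒ ◇≤ 1 (U i ∧ V' (fs j) ∧ σ)))
    i' : (i j : Fin n) (σ τ : Form n) → Lit (P i) σ → Lit (Q j) τ →
        Γ (⊡ (U (inject₁ i) ∧ V' (inject₁ j) ⇒
              ◇≤ 1 (U (fs i) ∧ V' (fs j) ∧ σ ∧ τ)))
    -- Γ₃,h  (k : Fin n stands for i = k+1, so u_{i-1} = U (inject₁ k))
    h1 : (k : Fin n) → Γ (□ (U top ∧ V' top ∧ pStar k ⇒ ◇ (Oh ∧ pPlus k)))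
    h2 : (k : Fin n) → Γ (□ (U top ∧ V' top ∧ pPlus k ⇒ ◇ (Oh ∧ pPlus k)))
    h3 : (k : Fin n) → Γ (□ (U (inject₁ k) ∧ V' top ⇒ ◇≤ 1 (Oh ∧ pPlus k)))
    v1 : (k : Fin n) → Γ (□ (U top ∧ V' top ∧ qStar k ⇒ ◇ (Ov ∧ qPlus k)))
    v2 : (k : Fin n) → Γ (□ (U top ∧ V' top ∧ qPlus k ⇒ ◇ (Ov ∧ qPlus k)))
    v3 : (k : Fin n) → Γ (□ (U top ∧ V' (inject₁ k) ⇒ ◇≤ 1 (Ov ∧ qPlus k)))

-- The model is the "grid of bit strings".  A grid world is a pair (as , bs)
-- of lists of booleans: as records the values of p₁ … p_|as| and bs those of
-- q₁ … q_|bs|; the world satisfies u_i iff i = |as|, v_j iff j = |bs|, and z.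
-- One grid world sees another iff both coordinates are extended (prefix
-- order), so moving right or up means appending one bit to a coordinate.
-- Besides the grid there are witness worlds (a , k), one for each axis a
-- (horizontal for o_h and the p's, vertical for o_v and the q's) and each
-- index k: it satisfies the marker o_a and exactly the k-th letter of its
-- axis, hence p_k^+ resp. q_k^+.  Every grid world sees every witness.
module Submission where

open import Defs
open import Data.Nat using (ℕ; zero; suc; pred; _<_; s≤s; _≡ᵇ_)
open import Data.Nat.Properties using (≡ᵇ⇒≡; ≡⇒≡ᵇ; <-irrefl)
open import Data.Fin using (Fin; toℕ; inject₁) renaming (zero to fz; suc to fs)
open import Data.Fin.Properties using (toℕ-inject₁; toℕ-injective)
open import Data.Bool using (Bool; true; false; T)
open import Data.Unit using (⊤; tt)
open import Data.Empty using (⊥-elim)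
open import Data.List using (List; []; _∷_; _++_; [_]; length; map)
open import Data.List.Properties using (++-identityʳ; ++-assoc; length-++-sucʳ)
open import Data.List.Relation.Unary.All as All using (All; []; _∷_)
open import Data.List.Relation.Unary.All.Properties using (all-filter; map⁺)
open import Data.Product using (Σ; ∃; _×_; _,_; proj₁; proj₂)
open import Relation.Binary.PropositionalEquality
  using (_≡_; refl; sym; trans; cong; cong₂; subst)
open import Relation.Binary.Definitions using (Reflexive; Transitive)
open import Relation.Nullary using (¬_)

module Semantics {n : ℕ} (S : Structure n) where

  -- φ holds at every world of S (a record, so that φ is recoverable
  -- from the type).
  record Valid (φ : Form n) : Set where
    constructor valid
    field holds : ∀ x → S , x ⊨ φ
  open Valid public

  □-intro : ∀ {w} (ψ : Form n) → (∀ y → R S w y → S , y ⊨ ψ) → S , w ⊨ □ ψ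
  □-intro ψ all (choice , _ , succ) = proj₂ (succ fz) (all (choice fz) (proj₁ (succ fz)))

  valid⇒□ : ∀ {w ψ} → Valid ψ → S , w ⊨ □ ψ
  valid⇒□ {ψ = ψ} ⊨ψ = □-intro ψ (λ y _ → holds ⊨ψ y)

  valid⇒⊡ : ∀ {w ψ} → Valid ψ → S , w ⊨ ⊡ ψ
  valid⇒⊡ ⊨ψ = holds ⊨ψ _ , valid⇒□ ⊨ψ

  ◇-intro : ∀ {w y} (ψ : Form n) → R S w y → S , y ⊨ ψ → S , w ⊨ ◇ ψ
  ◇-intro {y = y} ψ r ⊨ψ = (λ _ → y) , one-point , λ _ → r , ⊨ψ
    where
      one-point : ∀ {i j : Fin 1} → y ≡ y → i ≡ j
      one-point {fz} {fz} _ = refl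

  ◇≤1-intro : ∀ {w} (ψ : Form n) (c₀ : W S) →
              (∀ y → R S w y → S , y ⊨ ψ → y ≡ c₀) → S , w ⊨ ◇≤ 1 ψ
  ◇≤1-intro ψ c₀ unique (choice , injective , succ) =
    zero≢one (injective (trans (is-c₀ fz) (sym (is-c₀ (fs fz)))))
    where
      is-c₀ : ∀ k → choice k ≡ c₀
      is-c₀ k = unique (choice k) (proj₁ (succ k)) (proj₂ (succ k))
      zero≢one : ¬ (fz {1} ≡ fs fz)
      zero≢one ()

  ⋀-intro : ∀ {w} (φs : List (Form n)) → All (λ φ → S , w ⊨ φ) φs → S , w ⊨ ⋀ φs
  ⋀-intro []       []         = tt
  ⋀-intro (φ ∷ φs) (⊨φ ∷ ⊨φs) = ⊨φ , ⋀-intro φs ⊨φs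

  polarity : ∀ {ℓ : Letter n} {σ} → Lit (var ℓ) σ → Bool
  polarity pos = true
  polarity neg = false

  lit-intro : ∀ {x ℓ σ} (l : Lit (var ℓ) σ) → V S x ℓ ≡ polarity l → S , x ⊨ σ
  lit-intro pos eq = subst T (sym eq) tt
  lit-intro neg eq = subst T eq

  lit-elim : ∀ {x ℓ σ} (l : Lit (var ℓ) σ) → S , x ⊨ σ → V S x ℓ ≡ polarity l
  lit-elim {x} {ℓ} pos ⊨σ with V S x ℓ
  ... | true  = refl
  ... | false = ⊥-elim ⊨σ
  lit-elim {x} {ℓ} neg ⊨σ with V S x ℓ
  ... | true  = ⊥-elim (⊨σ tt)
  ... | false = refl

-- The m-th bit of a string, false beyond its end.
bitAt : List Bool → ℕ → Bool
bitAt []       _       = false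
bitAt (x ∷ xs) zero    = x
bitAt (x ∷ xs) (suc m) = bitAt xs m

infix 4 _≼_
_≼_ : List Bool → List Bool → Set
xs ≼ ys = ∃ λ rs → xs ++ rs ≡ ys

≼-refl : ∀ (xs : List Bool) → xs ≼ xs
≼-refl xs = [] , ++-identityʳ xs

≼-trans : ∀ {xs ys zs} → xs ≼ ys → ys ≼ zs → xs ≼ zs
≼-trans {xs} (rs , refl) (ss , refl) = rs ++ ss , sym (++-assoc xs rs ss)

≼-snoc : ∀ (xs : List Bool) bt → xs ≼ xs ++ [ bt ]
≼-snoc xs bt = [ bt ] , refl

≼-bitAt : ∀ {xs ys m} → xs ≼ ys → m < length xs → bitAt ys m ≡ bitAt xs m
≼-bitAt {xs} (rs , refl) = preserved xs
  where
    preserved : ∀ xs {m} → m < length xs → bitAt (xs ++ rs) m ≡ bitAt xs m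
    preserved (x ∷ xs) {zero}  _         = refl
    preserved (x ∷ xs) {suc m} (s≤s m<) = preserved xs m<

snoc-length : ∀ {m} (xs : List Bool) bt → m ≡ length xs → suc m ≡ length (xs ++ [ bt ])
snoc-length xs bt refl =
  sym (trans (length-++-sucʳ xs bt []) (cong (λ ys → suc (length ys)) (++-identityʳ xs)))

snoc-bit : ∀ {m} (xs : List Bool) bt → m ≡ length xs → bitAt (xs ++ [ bt ]) m ≡ bt
snoc-bit []       bt refl = refl
snoc-bit (x ∷ xs) bt refl = snoc-bit xs bt refl

≼-same-length : ∀ {xs ys m} → xs ≼ ys → m ≡ length xs → m ≡ length ys → ys ≡ xs
≼-same-length {xs} (rs , refl) refl eq = trans (cong (xs ++_) (empty xs rs eq)) (++-identityʳ xs)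
  where
    empty : ∀ xs rs → length xs ≡ length (xs ++ rs) → rs ≡ []
    empty []       []       _  = refl
    empty (x ∷ xs) rs       eq = empty xs rs (cong pred eq)

≼-next : ∀ {xs ys m bt} → xs ≼ ys → m ≡ length xs → suc m ≡ length ys →
         bitAt ys m ≡ bt → ys ≡ xs ++ [ bt ]
≼-next {xs} (rs , refl) refl eq bit = one-bit xs rs eq bit
  where
    one-bit : ∀ xs rs {bt} → suc (length xs) ≡ length (xs ++ rs) →
              bitAt (xs ++ rs) (length xs) ≡ bt → xs ++ rs ≡ xs ++ [ bt ]
    one-bit []       (r ∷ []) _  refl = refl
    one-bit (x ∷ xs) rs       eq bit  = cong (x ∷_) (one-bit xs rs (cong pred eq) bit)

data Axis : Set where
  horizontal vertical : Axis

module Model (n : ℕ) where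

  data World : Set where
    grid    : List Bool → List Bool → World
    witness : Axis → Fin n → World

  val : World → Letter n → Bool
  val (grid as bs) (u i)   = toℕ i ≡ᵇ length as
  val (grid as bs) (v j)   = toℕ j ≡ᵇ length bs
  val (grid as bs) (p k)   = bitAt as (toℕ k)
  val (grid as bs) (q k)   = bitAt bs (toℕ k)
  val (grid as bs) z       = true
  val (grid as bs) oh      = false
  val (grid as bs) ov      = false
  val (witness _ _) (u _)  = false
  val (witness _ _) (v _)  = false
  val (witness _ _) z      = false
  val (witness horizontal k) (p l) = toℕ l ≡ᵇ toℕ k
  val (witness vertical k)   (q l) = toℕ l ≡ᵇ toℕ k
  val (witness horizontal k) oh    = true
  val (witness vertical k)   ov    = true
  val (witness _ _) _      = false

  _⟶_ : World → World → Set
  grid as bs ⟶ grid as′ bs′ = as ≼ as′ × bs ≼ bs′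
  grid _ _   ⟶ witness _ _  = ⊤
  witness ax k ⟶ y           = y ≡ witness ax k

  ⟶-refl : Reflexive _⟶_
  ⟶-refl {grid as bs}  = ≼-refl as , ≼-refl bs
  ⟶-refl {witness _ _} = refl

  ⟶-trans : Transitive _⟶_
  ⟶-trans {grid _ _} {grid _ _} {grid _ _}    (ra , rb) (ra′ , rb′) = ≼-trans ra ra′ , ≼-trans rb rb′
  ⟶-trans {grid _ _} {grid _ _} {witness _ _} _ _       = tt
  ⟶-trans {grid _ _} {witness _ _}            _ refl    = tt
  ⟶-trans {witness _ _}                       refl refl = refl

  S : Structure n
  S = record { W = World ; R = _⟶_ ; V = val }

  open Semantics S public

  _⊩_ : World → Form n → Set
  x ⊩ φ = S , x ⊨ φ

  origin : World
  origin = grid [] []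

  data GridLetter : Letter n → Set where
    u-grid : ∀ i → GridLetter (u i)
    v-grid : ∀ j → GridLetter (v j)

  off-grid : ∀ {ℓ} → GridLetter ℓ → ∀ ax k → ¬ T (val (witness ax k) ℓ)
  off-grid (u-grid _) _ _ ()
  off-grid (v-grid _) _ _ ()

  grid-guarded : ∀ {ℓ} {ψ χ : Form n} → GridLetter ℓ →
                 (∀ as bs → grid as bs ⊩ (var ℓ ∧ ψ ⇒ χ)) → Valid (var ℓ ∧ ψ ⇒ χ)
  grid-guarded guard on-grid = valid λ
    { (grid as bs)            → on-grid as bs
    ; (witness ax k) (hℓ , _) → ⊥-elim (off-grid guard ax k hℓ) }

  inject-position : ∀ (i : Fin n) k → T (toℕ (inject₁ i) ≡ᵇ k) → toℕ i ≡ k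
  inject-position i k t = trans (sym (toℕ-inject₁ i)) (≡ᵇ⇒≡ _ k t)

  exclusive : (i j : Fin (suc n)) → toℕ i < toℕ j →
              Valid (~ (U i ∧ U j) ∧ ~ (V' i ∧ V' j))
  exclusive i j i<j = valid λ
    { (grid _ _)    → distinct , distinct
    ; (witness _ _) → (λ ()) , (λ ()) }
    where
      distinct : ∀ {k} → ¬ (T (toℕ i ≡ᵇ k) × T (toℕ j ≡ᵇ k))
      distinct {k} (ti , tj) = <-irrefl (trans (≡ᵇ⇒≡ _ k ti) (sym (≡ᵇ⇒≡ _ k tj))) i<j

  -- (c) appending the bit σ to the first coordinate is a step right.
  right-step : (i : Fin n) (j : Fin (suc n)) {σ : Form n} (l : Lit (P i) σ) →
               Valid (U (inject₁ i) ∧ V' j ∧ Z ⇒ ◇ (U (fs i) ∧ V' j ∧ Z ∧ σ))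
  right-step i j {σ} l = grid-guarded (u-grid _) λ as bs (hu , hv , _) →
    let i≡ = inject-position i (length as) hu in
    ◇-intro (U (fs i) ∧ V' j ∧ Z ∧ σ) (≼-snoc as (polarity l) , ≼-refl bs)
      (≡⇒≡ᵇ _ _ (snoc-length as _ i≡) , hv , tt , lit-intro l (snoc-bit as _ i≡))

  -- (d) appending the bit σ to the second coordinate is a step up.
  up-step : (i : Fin (suc n)) (j : Fin n) {σ : Form n} (l : Lit (Q j) σ) →
            Valid (U i ∧ V' (inject₁ j) ∧ Z ⇒ ◇ (U i ∧ V' (fs j) ∧ Z ∧ σ))
  up-step i j {σ} l = grid-guarded (u-grid _) λ as bs (hu , hv , _) →
    let j≡ = inject-position j (length bs) hv in
    ◇-intro (U i ∧ V' (fs j) ∧ Z ∧ σ) (≼-refl as , ≼-snoc bs (polarity l))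
      (hu , ≡⇒≡ᵇ _ _ (snoc-length bs _ j≡) , tt , lit-intro l (snoc-bit bs _ j≡))

  -- (e) once position i is passed, p_k (k ≤ i) is fixed in all extensions.
  p-persistent : (k : Fin n) (i : Fin (suc n)) → toℕ k < toℕ i →
                 {σ : Form n} (l : Lit (P k) σ) → Valid (U i ∧ σ ⇒ □ (Z ⇒ σ))
  p-persistent k i k<i {σ} l = grid-guarded (u-grid _) λ as bs (hu , hσ) →
    let k<|as| = subst (toℕ k <_) (≡ᵇ⇒≡ (toℕ i) (length as) hu) k<i in
    □-intro (Z ⇒ σ) λ
      { (grid _ _) (ra , _) _ → lit-intro l (trans (≼-bitAt ra k<|as|) (lit-elim l hσ))
      ; (witness _ _) _ () }

  -- (f) likewise for q_k along the second coordinate.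
  q-persistent : (k : Fin n) (j : Fin (suc n)) → toℕ k < toℕ j →
                 {σ : Form n} (l : Lit (Q k) σ) → Valid (V' j ∧ σ ⇒ □ (Z ⇒ σ))
  q-persistent k j k<j {σ} l = grid-guarded (v-grid _) λ as bs (hv , hσ) →
    let k<|bs| = subst (toℕ k <_) (≡ᵇ⇒≡ (toℕ j) (length bs) hv) k<j in
    □-intro (Z ⇒ σ) λ
      { (grid _ _) (_ , rb) _ → lit-intro l (trans (≼-bitAt rb k<|bs|) (lit-elim l hσ))
      ; (witness _ _) _ () }

  right-step-unique : (i : Fin n) (j : Fin (suc n)) {σ : Form n} (l : Lit (P i) σ) →
                      Valid (U (inject₁ i) ∧ V' j ⇒ ◇≤ 1 (U (fs i) ∧ V' j ∧ σ))
  right-step-unique i j {σ} l = grid-guarded (u-grid _) λ as bs (hu , hv) →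
    ◇≤1-intro (U (fs i) ∧ V' j ∧ σ) (grid (as ++ [ polarity l ]) bs) λ
      { (grid as′ bs′) (ra , rb) (hu′ , hv′ , hσ) →
          cong₂ grid (≼-next ra (inject-position i _ hu) (≡ᵇ⇒≡ _ (length as′) hu′) (lit-elim l hσ))
                     (≼-same-length rb (≡ᵇ⇒≡ (toℕ j) _ hv) (≡ᵇ⇒≡ (toℕ j) _ hv′))
      ; (witness _ _) _ (() , _) }

  up-step-unique : (i : Fin (suc n)) (j : Fin n) {σ : Form n} (l : Lit (Q j) σ) →
                   Valid (U i ∧ V' (inject₁ j) ⇒ ◇≤ 1 (U i ∧ V' (fs j) ∧ σ))
  up-step-unique i j {σ} l = grid-guarded (u-grid _) λ as bs (hu , hv) →
    ◇≤1-intro (U i ∧ V' (fs j) ∧ σ) (grid as (bs ++ [ polarity l ])) λ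
      { (grid as′ bs′) (ra , rb) (hu′ , hv′ , hσ) →
          cong₂ grid (≼-same-length ra (≡ᵇ⇒≡ (toℕ i) _ hu) (≡ᵇ⇒≡ (toℕ i) _ hu′))
                     (≼-next rb (inject-position j _ hv) (≡ᵇ⇒≡ _ (length bs′) hv′) (lit-elim l hσ))
      ; (witness _ _) _ (() , _) }

  diagonal-step-unique : (i j : Fin n) {σ τ : Form n} (l : Lit (P i) σ) (l′ : Lit (Q j) τ) →
    Valid (U (inject₁ i) ∧ V' (inject₁ j) ⇒ ◇≤ 1 (U (fs i) ∧ V' (fs j) ∧ σ ∧ τ))
  diagonal-step-unique i j {σ} {τ} l l′ = grid-guarded (u-grid _) λ as bs (hu , hv) →
    ◇≤1-intro (U (fs i) ∧ V' (fs j) ∧ σ ∧ τ)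
              (grid (as ++ [ polarity l ]) (bs ++ [ polarity l′ ])) λ
      { (grid as′ bs′) (ra , rb) (hu′ , hv′ , hσ , hτ) →
          cong₂ grid (≼-next ra (inject-position i _ hu) (≡ᵇ⇒≡ _ (length as′) hu′) (lit-elim l hσ))
                     (≼-next rb (inject-position j _ hv) (≡ᵇ⇒≡ _ (length bs′) hv′) (lit-elim l′ hτ))
      ; (witness _ _) _ (() , _) }

  -- Γ₃,h and Γ₃,v: the witness worlds; plus ax k is p_k^+ or q_k^+.

  marker : Axis → Letter n
  marker horizontal = oh
  marker vertical   = ov

  coord : Axis → Fin n → Letter n
  coord horizontal = p
  coord vertical   = q

  plus : Axis → Fin n → Form n
  plus ax k = var (coord ax k) ∧ ⋀ (map (λ l → ~ var (coord ax l)) (above k))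

  witness-marker : ∀ ax k → witness ax k ⊩ var (marker ax)
  witness-marker horizontal k = tt
  witness-marker vertical   k = tt

  witness-coord : ∀ ax k l → val (witness ax k) (coord ax l) ≡ (toℕ l ≡ᵇ toℕ k)
  witness-coord horizontal k l = refl
  witness-coord vertical   k l = refl

  witness-satisfies : ∀ ax k → witness ax k ⊩ (var (marker ax) ∧ plus ax k)
  witness-satisfies ax k =
      witness-marker ax k
    , subst T (sym (witness-coord ax k k)) (≡⇒≡ᵇ (toℕ k) _ refl)
    , ⋀-intro _ (map⁺ (All.map only-k (all-filter _ (allFin n))))
    where
      only-k : ∀ {l} → toℕ k < toℕ l → witness ax k ⊩ (~ var (coord ax l))
      only-k {l} k<l t =
        <-irrefl (sym (≡ᵇ⇒≡ (toℕ l) (toℕ k) (subst T (witness-coord ax k l) t))) k<l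

  witness-unique : ∀ ax k y → y ⊩ (var (marker ax) ∧ plus ax k) → y ≡ witness ax k
  witness-unique horizontal k (witness horizontal k′) (_ , hk , _) =
    cong (witness horizontal) (sym (toℕ-injective (≡ᵇ⇒≡ (toℕ k) (toℕ k′) hk)))
  witness-unique vertical k (witness vertical k′) (_ , hk , _) =
    cong (witness vertical) (sym (toℕ-injective (≡ᵇ⇒≡ (toℕ k) (toℕ k′) hk)))
  witness-unique horizontal k (grid _ _)           (() , _)
  witness-unique horizontal k (witness vertical _) (() , _)
  witness-unique vertical   k (grid _ _)           (() , _)
  witness-unique vertical   k (witness horizontal _) (() , _)

  -- (first two formulas of Γ₃) every grid world sees the witness (ax , k).
  witness-reachable : ∀ ax k i (ψ : Form n) →
                      Valid (U i ∧ ψ ⇒ ◇ (var (marker ax) ∧ plus ax k))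
  witness-reachable ax k i ψ = grid-guarded (u-grid i) λ _ _ _ →
    ◇-intro (var (marker ax) ∧ plus ax k) tt (witness-satisfies ax k)

  -- (third formula of Γ₃) the witness (ax , k) is the only such world.
  witness-at-most-one : ∀ ax k (ψ : Form n) → Valid (ψ ⇒ ◇≤ 1 (var (marker ax) ∧ plus ax k))
  witness-at-most-one ax k ψ = valid λ x _ →
    ◇≤1-intro (var (marker ax) ∧ plus ax k) (witness ax k) (λ y _ → witness-unique ax k y)

  origin-satisfies-Γ : (φ : Form n) → Γ φ → origin ⊩ φ
  origin-satisfies-Γ _ a                  = tt , tt , tt
  origin-satisfies-Γ _ (b i j i<j)        = valid⇒⊡ (exclusive i j i<j)
  origin-satisfies-Γ _ (c i j _ l)        = valid⇒⊡ (right-step i j l)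
  origin-satisfies-Γ _ (d i j _ l)        = valid⇒⊡ (up-step i j l)
  origin-satisfies-Γ _ (e k i k<i _ l)    = valid⇒□ (p-persistent k i k<i l)
  origin-satisfies-Γ _ (f k j k<j _ l)    = valid⇒□ (q-persistent k j k<j l)
  origin-satisfies-Γ _ (g i j _ l)        = valid⇒⊡ (right-step-unique i j l)
  origin-satisfies-Γ _ (h i j _ l)        = valid⇒⊡ (up-step-unique i j l)
  origin-satisfies-Γ _ (i' i j _ _ l l′)  = valid⇒⊡ (diagonal-step-unique i j l l′)
  origin-satisfies-Γ _ (h1 k) = valid⇒□ (witness-reachable horizontal k top (V' top ∧ pStar k))
  origin-satisfies-Γ _ (h2 k) = valid⇒□ (witness-reachable horizontal k top (V' top ∧ pPlus k))
  origin-satisfies-Γ _ (h3 k) = valid⇒□ (witness-at-most-one horizontal k (U (inject₁ k) ∧ V' top))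
  origin-satisfies-Γ _ (v1 k) = valid⇒□ (witness-reachable vertical k top (V' top ∧ qStar k))
  origin-satisfies-Γ _ (v2 k) = valid⇒□ (witness-reachable vertical k top (V' top ∧ qPlus k))
  origin-satisfies-Γ _ (v3 k) = valid⇒□ (witness-at-most-one vertical k (U top ∧ V' (inject₁ k)))

lemma14 : (n : ℕ) → 0 < n →
    Σ (Structure n) λ S → Reflexive (R S) × Transitive (R S) ×
    Σ (W S) λ w₀ → (φ : Form n) → Γ φ → S , w₀ ⊨ φ
lemma14 n _ = S , ⟶-refl , ⟶-trans , origin , origin-satisfies-Γ
  where open Model n
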